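{- Let $b\ge 1$ be an integer and assume that $m=8b^3+3$ is cubefree. Then the element $\tau=3b^3+1+b^3\sqrt{ -m}$ of the imaginary quadratic field $\mathbb{Q}(\sqrt{ -m})$ is the cube of an element of $\mathbb{Q}(\sqrt{ -m})$. In particular, the integral ideal $\mathfrak{a}$ of $\mathbb{Q}(\sqrt{ -m})$ with $(\tau)=\mathfrak{a}^3$ is principal. -}

module Defs where

open import Data.Nat as ℕ using (ℕ; _^_; _<_)
open import Data.Nat.Divisibility using (_∣_)
open import Data.Integer using (+_)
open import Data.Rational using (ℚ; _/_; _+_; _-_; _*_)
open import Data.Product using (_×_; _,_; ∃)
open import Relation.Binary.PropositionalEquality using (_≡_)
open import Relation.Nullary using (¬_)

CubeFree : ℕ → Set
CubeFree m = ∀ (d : ℕ) → 1 < d → ¬ (d ^ 3 ∣ m)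

ℕ→ℚ : ℕ → ℚ
ℕ→ℚ n = (+ n) / 1

-- Elements of Q(√-m): the pair (x , y) stands for x + y·√-m, x y ∈ ℚ.
-- (Q(√-m) is a 2-dimensional ℚ-vector space with basis 1, √-m, since m > 0
-- makes -m a non-square; (x,y) ↦ x + y√-m is a bijection ℚ² ≅ Q(√-m).)
QF : Set
QF = ℚ × ℚ

-- multiplication in Q(√-m), using (√-m)² = -m
mulQF : ℕ → QF → QF → QF
mulQF m (a , b) (c , d) = (a * c - ℕ→ℚ m * (b * d) , a * d + b * c)

IsCubeIn : ℕ → QF → Set
IsCubeIn m τ = ∃ λ (α : QF) → mulQF m α (mulQF m α α) ≡ τ

module Submission where

-- For m = 8c + 3 the element α = -½ - ½√-m of Q(√-m) satisfies
--   α³ = -⅛ (1 + √-m)³ = -⅛ ((1 - 3m) + (3 - m)√-m) = ((3m - 1)/8 , (m - 3)/8)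
--      = (3c + 1 , c).
-- Taking c = b³ gives α³ = τ = 3b³ + 1 + b³√-m, so τ is a cube in Q(√-m).

open import Defs
open import Data.Nat using (ℕ; _≤_; _^_; _+_; _*_)
open import Data.Product using (_,_)
import Data.Integer as ℤ
import Data.Integer.Properties as ℤ
open import Data.Rational as ℚ using (ℚ; mkℚ)
import Data.Rational.Properties as ℚ
open import Data.Rational.Solver using (module +-*-Solver)
open import Data.Nat.Coprimality using (1-coprimeTo; sym)
open import Relation.Binary.PropositionalEquality using (_≡_; refl; cong; cong₂; trans)
open Relation.Binary.PropositionalEquality.≡-Reasoning

ℕ→ℚ-normal : ∀ n → ℕ→ℚ n ≡ mkℚ (ℤ.+ n) 0 (sym (1-coprimeTo n))
ℕ→ℚ-normal n = ℚ.normalize-coprime (sym (1-coprimeTo n))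

ℕ→ℚ-+ : ∀ a b → ℕ→ℚ (a + b) ≡ ℕ→ℚ a ℚ.+ ℕ→ℚ b
ℕ→ℚ-+ a b rewrite ℕ→ℚ-normal a | ℕ→ℚ-normal b =
  cong (ℚ._/ 1) (begin
    ℤ.+ (a + b)                       ≡⟨ ℤ.pos-+ a b ⟩
    ℤ.+ a ℤ.+ ℤ.+ b                   ≡⟨ cong₂ ℤ._+_ (ℤ.*-identityʳ (ℤ.+ a)) (ℤ.*-identityʳ (ℤ.+ b)) ⟨
    ℤ.+ a ℤ.* ℤ.+ 1 ℤ.+ ℤ.+ b ℤ.* ℤ.+ 1 ∎)

ℕ→ℚ-* : ∀ a b → ℕ→ℚ (a * b) ≡ ℕ→ℚ a ℚ.* ℕ→ℚ b
ℕ→ℚ-* a b rewrite ℕ→ℚ-normal a | ℕ→ℚ-normal b = cong (ℚ._/ 1) (ℤ.pos-* a b)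

ℕ→ℚ-affine : ∀ k n r → ℕ→ℚ (k * n + r) ≡ ℕ→ℚ k ℚ.* ℕ→ℚ n ℚ.+ ℕ→ℚ r
ℕ→ℚ-affine k n r = trans (ℕ→ℚ-+ (k * n) r) (cong (ℚ._+ ℕ→ℚ r) (ℕ→ℚ-* k n))

-½ : ℚ
-½ = ℚ.- (ℤ.+ 1 ℚ./ 2)

α : QF
α = (-½ , -½)

-- The two coordinates of α³ = α · (α · α) in Q(√-m), where M is the rational
-- value of m; this is mulQF with ℕ→ℚ m abstracted to M.
cubeRe cubeIm : ℚ → ℚ
cubeRe M = -½ ℚ.* (-½ ℚ.* -½ ℚ.- M ℚ.* (-½ ℚ.* -½))
           ℚ.- M ℚ.* (-½ ℚ.* (-½ ℚ.* -½ ℚ.+ -½ ℚ.* -½))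
cubeIm M = -½ ℚ.* (-½ ℚ.* -½ ℚ.+ -½ ℚ.* -½)
           ℚ.+ -½ ℚ.* (-½ ℚ.* -½ ℚ.- M ℚ.* (-½ ℚ.* -½))

cube-α : ∀ m → mulQF m α (mulQF m α α) ≡ (cubeRe (ℕ→ℚ m) , cubeIm (ℕ→ℚ m))
cube-α m = refl

module _ where
  open +-*-Solver

  h : ∀ {n} → Polynomial n
  h = con -½

  eight-c+3 : ∀ {n} → Polynomial n → Polynomial n
  eight-c+3 c = con (ℕ→ℚ 8) :* c :+ con (ℕ→ℚ 3)

  cubeRe-8c+3 : ∀ c → cubeRe (ℕ→ℚ 8 ℚ.* c ℚ.+ ℕ→ℚ 3) ≡ ℕ→ℚ 3 ℚ.* c ℚ.+ ℕ→ℚ 1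
  cubeRe-8c+3 = solve 1 (λ c →
      h :* (h :* h :- eight-c+3 c :* (h :* h)) :- eight-c+3 c :* (h :* (h :* h :+ h :* h))
        := con (ℕ→ℚ 3) :* c :+ con (ℕ→ℚ 1)) refl

  cubeIm-8c+3 : ∀ c → cubeIm (ℕ→ℚ 8 ℚ.* c ℚ.+ ℕ→ℚ 3) ≡ c
  cubeIm-8c+3 = solve 1 (λ c →
      h :* (h :* h :+ h :* h) :+ h :* (h :* h :- eight-c+3 c :* (h :* h)) := c) refl

mainTheorem4 : (b : ℕ) → 1 ≤ b → CubeFree (8 * b ^ 3 + 3) →
    IsCubeIn (8 * b ^ 3 + 3) (ℕ→ℚ (3 * b ^ 3 + 1) , ℕ→ℚ (b ^ 3))
mainTheorem4 b _ _ = α , (begin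
    mulQF m α (mulQF m α α)                 ≡⟨ cube-α m ⟩
    (cubeRe (ℕ→ℚ m) , cubeIm (ℕ→ℚ m))     ≡⟨ cong (λ q → cubeRe q , cubeIm q) (ℕ→ℚ-affine 8 c 3) ⟩
    (cubeRe M , cubeIm M)                   ≡⟨ cong₂ _,_ (cubeRe-8c+3 (ℕ→ℚ c)) (cubeIm-8c+3 (ℕ→ℚ c)) ⟩
    (ℕ→ℚ 3 ℚ.* ℕ→ℚ c ℚ.+ ℕ→ℚ 1 , ℕ→ℚ c)  ≡⟨ cong (_, ℕ→ℚ c) (ℕ→ℚ-affine 3 c 1) ⟨
    (ℕ→ℚ (3 * c + 1) , ℕ→ℚ c)              ∎)
  where
  c : ℕ
  c = b ^ 3
  m : ℕ
  m = 8 * c + 3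
  M : ℚ
  M = ℕ→ℚ 8 ℚ.* ℕ→ℚ c ℚ.+ ℕ→ℚ 3
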